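{- Let $T$ be a set of rooted binary phylogenetic trees on the same leaf set $X$, let $C$ be a constraint set on $T$, let $s=(s_1,s_2,\dots)$ be a cherry picking sequence for $T$ that satisfies $C$, and let $x\in H(T)$. Then at least one of the following holds: (1) there is $i$ with $s_i=x$ such that $s'=(s_i,s_1,\dots,s_{i-1},s_{i+1},\dots)$ is a cherry picking sequence for $T$ satisfying $C$ with $w_T(s')=w_T(s)$; (2) if $s_i=x$ then there is $j<i$ with $s_j\in N_T(x)$.
   Context: A tree is a rooted binary phylogenetic $X$-tree. $\mathcal{T}\setminus A$ is obtained by deleting the leaves in $A$ and repeatedly suppressing vertices with in- and out-degree one; $T\setminus A=\{\mathcal{T}\setminus A:\mathcal{T}\in T\}$. A cherry is a pair of leaves with a common parent; $(a,b)\in\mathcal{T}$ (symmetric) means $\{a,b\}$ is a cherry of $\mathcal{T}$; $(a,b)\in T$ means it is a cherry of some tree in $T$. $H(T)$ is the set of leaves in a cherry in every tree of $T$. $N_T(x)=\{y:(y,x)\in\mathcal{T}\text{ for some }\mathcal{T}\in T\}$, $w_T(x)=|N_T(x)|-1$. A cherry picking sequence for $T$ is a sequence $s=(s_1,\dots,s_n)$ containing each leaf exactly once with $s_i\in H(T\setminus\{s_1,\dots,s_{i-1}\})$ for $i\le n-1$; its weight is $w_T(s)=\sum_{i=1}^{n-1}w_{T\setminus\{s_1,\dots,s_{i-1}\}}(s_i)$. A constraint set on $T$ is $C\subseteq X\times X$ with every pair a cherry in $T$; $s$ satisfies $C$ if for every $(a,b)\in C$ there is $i$ with $s_i=a$,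 $(a,b)\in T'$ and $w_{T'}(a)>0$, where $T'=T\setminus\{s_1,\dots,s_{i-1}\}$. -}

module Defs where

open import Data.Nat using (ℕ; zero; suc; _≟_; _∸_; _+_; _<_)
open import Data.Bool using (Bool; true; false; if_then_else_)
open import Data.Maybe using (Maybe; just; nothing)
open import Data.Product using (_×_; _,_; Σ; ∃; ∃-syntax)
open import Data.Sum using (_⊎_)
open import Data.List using (List; []; _∷_; _++_; [_]; length; mapMaybe; concatMap; deduplicate)
open import Data.Bool.ListAction using (any)
open import Data.List.Membership.Propositional using (_∈_)
open import Data.List.Relation.Unary.Unique.Propositional using (Unique)
open import Data.List.Relation.Binary.Permutation.Propositional using (_↭_)
open import Relation.Nullary.Decidable using (⌊_⌋)
open import Relation.Binary.PropositionalEquality using (_≡_; _≢_)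

-- Leaves are labelled by natural numbers.
-- A rooted binary phylogenetic tree: every internal vertex has exactly two
-- children (children unordered semantically; order is irrelevant below).
data BTree : Set where
  leaf : ℕ → BTree
  node : BTree → BTree → BTree

leaves : BTree → List ℕ
leaves (leaf x)   = [ x ]
leaves (node l r) = leaves l ++ leaves r

-- 𝒯 is a rooted binary phylogenetic X-tree (X given as a duplicate-free list)
IsXTree : List ℕ → BTree → Set
IsXTree X t = leaves t ↭ X

cherries : BTree → List (ℕ × ℕ)
cherries (leaf x) = []
cherries (node (leaf a) (leaf b)) = [ (a , b) ]
cherries (node l r) = cherries l ++ cherries r

CherryOf : ℕ → ℕ → BTree → Set
CherryOf a b t = ((a , b) ∈ cherries t) ⊎ ((b , a) ∈ cherries t)

CherryIn : ℕ → ℕ → List BTree → Set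
CherryIn a b T = ∃[ t ] (t ∈ T × CherryOf a b t)

-- deleting the leaves in A and suppressing degree-2 vertices
-- (nothing = the empty tree, when all leaves are deleted)
_∈ᵇ_ : ℕ → List ℕ → Bool
x ∈ᵇ A = any (λ y → ⌊ x ≟ y ⌋) A

del : List ℕ → BTree → Maybe BTree
del A (leaf x) = if x ∈ᵇ A then nothing else just (leaf x)
del A (node l r) with del A l | del A r
... | just l' | just r' = just (node l' r')
... | just l' | nothing = just l'
... | nothing | just r' = just r'
... | nothing | nothing = nothing

_∖_ : List BTree → List ℕ → List BTree
T ∖ A = mapMaybe (del A) T

InH : ℕ → List BTree → Set
InH x T = ∀ t → t ∈ T → ∃[ y ] CherryOf x y t

partners : ℕ → List (ℕ × ℕ) → List ℕ
partners x [] = []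
partners x ((a , b) ∷ cs) with ⌊ a ≟ x ⌋ | ⌊ b ≟ x ⌋
... | true  | _     = b ∷ partners x cs
... | false | true  = a ∷ partners x cs
... | false | false = partners x cs

N : List BTree → ℕ → List ℕ
N T x = deduplicate _≟_ (concatMap (λ t → partners x (cherries t)) T)

w : List BTree → ℕ → ℕ
w T x = length (N T x) ∸ 1

IsCPS : List BTree → List ℕ → List ℕ → Set
IsCPS T X s = (s ↭ X) ×
  (∀ p x rest → s ≡ p ++ x ∷ rest → rest ≢ [] → InH x (T ∖ p))

-- weight: sum over i ≤ n-1 of w_{T ∖ {s_1..s_{i-1}}}(s_i); p = picked prefix
weightAux : List BTree → List ℕ → List ℕ → ℕ
weightAux T p [] = 0
weightAux T p (x ∷ []) = 0
weightAux T p (x ∷ y ∷ r) = w (T ∖ p) x + weightAux T (p ++ [ x ]) (y ∷ r)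

weight : List BTree → List ℕ → ℕ
weight T s = weightAux T [] s

IsConstraintSet : List BTree → List (ℕ × ℕ) → Set
IsConstraintSet T C = ∀ a b → (a , b) ∈ C → CherryIn a b T

Satisfies : List BTree → List (ℕ × ℕ) → List ℕ → Set
Satisfies T C s = ∀ a b → (a , b) ∈ C →
  ∃[ p ] ∃[ rest ] (s ≡ p ++ a ∷ rest × CherryIn a b (T ∖ p) × 0 < w (T ∖ p) a)

module Submission where

-- Write s = p ++ x ∷ rest with x ∉ p (first occurrence).  If a leaf of p is a
-- cherry partner of x in some tree of T, alternative (2) holds.  Otherwise
-- s' = x ∷ p ++ rest is again a cherry picking sequence satisfying C, of the
-- same weight.  Everything rests on one locality fact about a single tree
-- (del-keeps-nbrs): deleting leaves that avoid a cherry {a, z} does not change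
-- the cherry partners of a.  Since p avoids x and all partners of x, deleting
-- any part of p leaves the partners of x unchanged (x-view-stable); and when a
-- leaf a of p is in a cherry {a, z}, then z ≠ x, so deleting x in addition
-- changes nothing for a (picked-before-x).  Cherries of a in a forest and the
-- weight w(a) depend only on the list of partners of a (view-transfer), so
-- the cherry picking condition, the constraints and the weight all carry over
-- from s to s'.

open import Defs
open import Data.Nat using (ℕ; _≟_; _∸_; _+_; _<_)
open import Data.Nat.Properties using (+-assoc; +-commutativeSemigroup)
open import Algebra.Properties.CommutativeSemigroup +-commutativeSemigroup using (x∙yz≈y∙xz)
open import Data.Bool using (_∨_; true; false; not; T?)
open import Data.Bool.Properties using (∨-assoc; ∨-comm; ∨-zeroʳ; ∨-identityʳ)
open import Data.Maybe using (Maybe; just; nothing; _>>=_)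
open import Data.Maybe.Properties using (just-injective)
open import Data.Product using (_×_; _,_; ∃-syntax; proj₁; proj₂)
open import Data.Sum using (_⊎_; inj₁; inj₂) renaming (swap to ⊎-swap; map to ⊎-map)
open import Data.Empty using (⊥; ⊥-elim)
open import Function using (_∘_)
open import Data.List using (List; []; _∷_; _++_; [_]; mapMaybe; concatMap; concat; filter; deduplicate; length)
open import Data.List.Properties using (++-assoc; ++-identityʳ; ∷-injective; filter-++; map-cong-local; mapMaybe-cong)
open import Data.List.Membership.Propositional using (_∈_; _∉_; find; lose)
open import Data.List.Membership.Propositional.Properties
  using (∈-++⁺ˡ; ∈-++⁺ʳ; ∈-++⁻; ∈-filter⁻; ∈-deduplicate⁺; ∈-concatMap⁺; ∈-concatMap⁻)
open import Data.List.Membership.DecPropositional _≟_ using (_∈?_)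
open import Data.List.Relation.Binary.Subset.Propositional using (_⊆_)
open import Data.List.Relation.Binary.Subset.Propositional.Properties using (xs⊆xs++ys; ⊆-reflexive)
open import Data.List.Relation.Unary.Any using (here; there; any?)
import Data.List.Relation.Unary.All as All
open import Data.List.Relation.Unary.All.Properties using (++⁻ˡ)
open import Data.List.Relation.Unary.AllPairs using ([]; _∷_)
open import Data.List.Relation.Unary.Unique.Propositional using (Unique)
open import Data.List.Relation.Unary.Unique.Propositional.Properties using (filter⁺)
open import Data.List.Relation.Binary.Permutation.Propositional using (_↭_; ↭-sym; ↭-trans; ↭⇒↭ₛ)
open import Data.List.Relation.Binary.Permutation.Propositional.Properties using (shift; ∈-resp-↭)
open import Relation.Binary.PropositionalEquality.Properties using (setoid)
open import Data.List.Relation.Binary.Permutation.Setoid.Properties (setoid ℕ) using (Unique-resp-↭)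
open import Relation.Nullary using (yes; no)
open import Relation.Nullary.Decidable using (⌊_⌋)
open import Relation.Binary.PropositionalEquality
  using (_≡_; _≢_; refl; sym; trans; cong; cong₂; subst; module ≡-Reasoning)

∈ᵇ-++ : ∀ z A B → z ∈ᵇ (A ++ B) ≡ (z ∈ᵇ A) ∨ (z ∈ᵇ B)
∈ᵇ-++ z [] B = refl
∈ᵇ-++ z (a ∷ A) B rewrite ∈ᵇ-++ z A B = sym (∨-assoc ⌊ z ≟ a ⌋ (z ∈ᵇ A) (z ∈ᵇ B))

∉⇒∈ᵇ≡false : ∀ {z A} → z ∉ A → z ∈ᵇ A ≡ false
∉⇒∈ᵇ≡false {z} {[]} _ = refl
∉⇒∈ᵇ≡false {z} {a ∷ A} z∉ with z ≟ a
... | yes z≡a = ⊥-elim (z∉ (here z≡a))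
... | no _ = ∉⇒∈ᵇ≡false (z∉ ∘ there)

infix 4 _≐_
record _≐_ (A B : List ℕ) : Set where
  constructor same-deleted
  field deleted : ∀ z → z ∈ᵇ A ≡ z ∈ᵇ B
open _≐_

≐-∷ʳ : ∀ {A B} a → A ≐ B → A ++ [ a ] ≐ B ++ [ a ]
≐-∷ʳ {A} {B} a A≐B = same-deleted λ z → begin
  z ∈ᵇ (A ++ [ a ])          ≡⟨ ∈ᵇ-++ z A [ a ] ⟩
  z ∈ᵇ A ∨ z ∈ᵇ [ a ]        ≡⟨ cong (_∨ z ∈ᵇ [ a ]) (deleted A≐B z) ⟩
  z ∈ᵇ B ∨ z ∈ᵇ [ a ]        ≡⟨ sym (∈ᵇ-++ z B [ a ]) ⟩
  z ∈ᵇ (B ++ [ a ])          ∎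
  where open ≡-Reasoning

move-front-≐ : ∀ x p q → x ∷ p ++ q ≐ p ++ x ∷ q
move-front-≐ x p q = same-deleted λ z → begin
  ⌊ z ≟ x ⌋ ∨ z ∈ᵇ (p ++ q)        ≡⟨ cong (⌊ z ≟ x ⌋ ∨_) (∈ᵇ-++ z p q) ⟩
  ⌊ z ≟ x ⌋ ∨ (z ∈ᵇ p ∨ z ∈ᵇ q)    ≡⟨ sym (∨-assoc ⌊ z ≟ x ⌋ _ _) ⟩
  (⌊ z ≟ x ⌋ ∨ z ∈ᵇ p) ∨ z ∈ᵇ q    ≡⟨ cong (_∨ z ∈ᵇ q) (∨-comm ⌊ z ≟ x ⌋ _) ⟩
  (z ∈ᵇ p ∨ ⌊ z ≟ x ⌋) ∨ z ∈ᵇ q    ≡⟨ ∨-assoc (z ∈ᵇ p) _ _ ⟩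
  z ∈ᵇ p ∨ (⌊ z ≟ x ⌋ ∨ z ∈ᵇ q)    ≡⟨ sym (∈ᵇ-++ z p (x ∷ q)) ⟩
  z ∈ᵇ (p ++ x ∷ q)                 ∎
  where open ≡-Reasoning

combine : Maybe BTree → Maybe BTree → Maybe BTree
combine (just l) (just r) = just (node l r)
combine (just l) nothing  = just l
combine nothing  mr       = mr

del-node : ∀ A l r → del A (node l r) ≡ combine (del A l) (del A r)
del-node A l r with del A l | del A r
... | just _  | just _  = refl
... | just _  | nothing = refl
... | nothing | just _  = refl
... | nothing | nothing = refl

del-resp-≐ : ∀ {A B} → A ≐ B → ∀ t → del A t ≡ del B t
del-resp-≐ A≐B (leaf z) rewrite deleted A≐B z = refl
del-resp-≐ {A} {B} A≐B (node l r)
  rewrite del-node A l r | del-node B l r | del-resp-≐ A≐B l | del-resp-≐ A≐B r = refl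

del-[] : ∀ t → del [] t ≡ just t
del-[] (leaf x) = refl
del-[] (node l r) rewrite del-node [] l r | del-[] l | del-[] r = refl

del-++ : ∀ B A t → del (B ++ A) t ≡ (del A t >>= del B)
del-++ B A (leaf z) rewrite ∈ᵇ-++ z B A with z ∈ᵇ A
... | true  rewrite ∨-zeroʳ (z ∈ᵇ B) = refl
... | false rewrite ∨-identityʳ (z ∈ᵇ B) = refl
del-++ B A (node l r)
  rewrite del-node (B ++ A) l r | del-++ B A l | del-++ B A r | del-node A l r
  = combine-bind (del A l) (del A r)
  where
  combine-bind : ∀ ml mr → combine (ml >>= del B) (mr >>= del B) ≡ (combine ml mr >>= del B)
  combine-bind (just l) (just r) = sym (del-node B l r)
  combine-bind (just l) nothing with del B l
  ... | just _  = refl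
  ... | nothing = refl
  combine-bind nothing mr = refl

leaves-del : ∀ A t {u} → del A t ≡ just u → leaves u ≡ filter (λ z → T? (not (z ∈ᵇ A))) (leaves t)
leaves-del A t e = trans (cong mleaves (sym e)) (mleaves-del t)
  where
  mleaves : Maybe BTree → List ℕ
  mleaves nothing  = []
  mleaves (just u) = leaves u

  mleaves-combine : ∀ ml mr → mleaves (combine ml mr) ≡ mleaves ml ++ mleaves mr
  mleaves-combine (just l) (just r) = refl
  mleaves-combine (just l) nothing  = sym (++-identityʳ (leaves l))
  mleaves-combine nothing  mr       = refl

  mleaves-del : ∀ t → mleaves (del A t) ≡ filter (λ z → T? (not (z ∈ᵇ A))) (leaves t)
  mleaves-del (leaf z) with z ∈ᵇ A
  ... | true  = refl
  ... | false = refl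
  mleaves-del (node l r)
    rewrite del-node A l r | mleaves-combine (del A l) (del A r)
          | filter-++ (λ z → T? (not (z ∈ᵇ A))) (leaves l) (leaves r)
          | mleaves-del l | mleaves-del r = refl

del-⊆ : ∀ A {t u} → del A t ≡ just u → leaves u ⊆ leaves t
del-⊆ A {t} e {z} z∈u = proj₁ (∈-filter⁻ (λ z → T? (not (z ∈ᵇ A))) (subst (z ∈_) (leaves-del A t e) z∈u))

del-unique : ∀ A {t u} → del A t ≡ just u → Unique (leaves t) → Unique (leaves u)
del-unique A {t} e U rewrite leaves-del A t e = filter⁺ (λ z → T? (not (z ∈ᵇ A))) U

del-leaf : ∀ {A k} → k ∉ A → del A (leaf k) ≡ just (leaf k)
del-leaf k∉A rewrite ∉⇒∈ᵇ≡false k∉A = refl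

unique-++ˡ : ∀ {xs ys : List ℕ} → Unique (xs ++ ys) → Unique xs
unique-++ˡ {[]}     _        = []
unique-++ˡ {x ∷ xs} (x∉ ∷ U) = ++⁻ˡ xs x∉ ∷ unique-++ˡ U

unique-++ʳ : ∀ {xs ys : List ℕ} → Unique (xs ++ ys) → Unique ys
unique-++ʳ {[]}     U       = U
unique-++ʳ {x ∷ xs} (_ ∷ U) = unique-++ʳ {xs} U

unique-disjoint : ∀ {xs ys : List ℕ} {z} → Unique (xs ++ ys) → z ∈ xs → z ∉ ys
unique-disjoint {x ∷ xs} (x∉ ∷ _) (here refl) z∈ys = All.lookup x∉ (∈-++⁺ʳ xs z∈ys) refl
unique-disjoint {x ∷ xs} (_ ∷ U)  (there z∈xs) = unique-disjoint {xs} U z∈xs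

data NodeShape : BTree → BTree → Set where
  leafPair : ∀ a b → NodeShape (leaf a) (leaf b)
  inner    : ∀ {l r} → cherries (node l r) ≡ cherries l ++ cherries r → NodeShape l r

nodeShape : ∀ l r → NodeShape l r
nodeShape (leaf a)   (leaf b)   = leafPair a b
nodeShape (leaf a)   (node _ _) = inner refl
nodeShape (node _ _) r          = inner refl

cherryOf-inner : ∀ {a z} l r → cherries (node l r) ≡ cherries l ++ cherries r →
  CherryOf a z (node l r) → CherryOf a z l ⊎ CherryOf a z r
cherryOf-inner l r eq (inj₁ m) = ⊎-map inj₁ inj₁ (∈-++⁻ (cherries l) (subst (_ ∈_) eq m))
cherryOf-inner l r eq (inj₂ m) = ⊎-map inj₂ inj₂ (∈-++⁻ (cherries l) (subst (_ ∈_) eq m))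

cherry-leaves : ∀ t {u v} → (u , v) ∈ cherries t → u ∈ leaves t × v ∈ leaves t
cherry-leaves (leaf _) ()
cherry-leaves (node l r) m with nodeShape l r
... | leafPair a b with m
...   | here refl = here refl , there (here refl)
cherry-leaves (node l r) m | inner eq with ∈-++⁻ (cherries l) (subst (_ ∈_) eq m)
... | inj₁ ml = let u∈ , v∈ = cherry-leaves l ml in ∈-++⁺ˡ u∈ , ∈-++⁺ˡ v∈
... | inj₂ mr = let u∈ , v∈ = cherry-leaves r mr in ∈-++⁺ʳ (leaves l) u∈ , ∈-++⁺ʳ (leaves l) v∈

cherryOf-leaf : ∀ {a z} t → CherryOf a z t → a ∈ leaves t
cherryOf-leaf t (inj₁ m) = proj₁ (cherry-leaves t m)
cherryOf-leaf t (inj₂ m) = proj₂ (cherry-leaves t m)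

cherry-distinct : ∀ t {u v} → Unique (leaves t) → (u , v) ∈ cherries t → u ≢ v
cherry-distinct (leaf _) _ ()
cherry-distinct (node l r) U m with nodeShape l r
... | leafPair a b with m | U
...   | here refl | a∉rest ∷ _ = All.head a∉rest
cherry-distinct (node l r) U m | inner eq with ∈-++⁻ (cherries l) (subst (_ ∈_) eq m)
... | inj₁ ml = cherry-distinct l (unique-++ˡ {leaves l} U) ml
... | inj₂ mr = cherry-distinct r (unique-++ʳ {leaves l} U) mr

no-self-cherry : ∀ {a} t → Unique (leaves t) → CherryOf a a t → ⊥
no-self-cherry t U (inj₁ m) = cherry-distinct t U m refl
no-self-cherry t U (inj₂ m) = cherry-distinct t U m refl

partners-++ : ∀ a cs ds → partners a (cs ++ ds) ≡ partners a cs ++ partners a ds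
partners-++ a [] ds = refl
partners-++ a ((u , v) ∷ cs) ds with ⌊ u ≟ a ⌋ | ⌊ v ≟ a ⌋
... | true  | _     = cong (v ∷_) (partners-++ a cs ds)
... | false | true  = cong (u ∷_) (partners-++ a cs ds)
... | false | false = partners-++ a cs ds

partners⁺ : ∀ {a b} cs → (a , b) ∈ cs ⊎ (b , a) ∈ cs → b ∈ partners a cs
partners⁺ [] (inj₁ ())
partners⁺ [] (inj₂ ())
partners⁺ {a} ((u , v) ∷ cs) m with u ≟ a | v ≟ a | m
... | yes refl | _        | inj₁ (here refl)  = here refl
... | yes refl | _        | inj₂ (here refl)  = here refl
... | yes _    | _        | inj₁ (there m')   = there (partners⁺ cs (inj₁ m'))
... | yes _    | _        | inj₂ (there m')   = there (partners⁺ cs (inj₂ m'))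
... | no u≢a   | _        | inj₁ (here refl)  = ⊥-elim (u≢a refl)
... | no _     | yes refl | inj₂ (here refl)  = here refl
... | no _     | no v≢a   | inj₂ (here refl)  = ⊥-elim (v≢a refl)
... | no _     | yes _    | inj₁ (there m')   = there (partners⁺ cs (inj₁ m'))
... | no _     | yes _    | inj₂ (there m')   = there (partners⁺ cs (inj₂ m'))
... | no _     | no _     | inj₁ (there m')   = partners⁺ cs (inj₁ m')
... | no _     | no _     | inj₂ (there m')   = partners⁺ cs (inj₂ m')

partners⁻ : ∀ {a b} cs → b ∈ partners a cs → (a , b) ∈ cs ⊎ (b , a) ∈ cs
partners⁻ {a} ((u , v) ∷ cs) m with u ≟ a | v ≟ a | m
... | yes refl | _        | here refl = inj₁ (here refl)
... | yes _    | _        | there m'  = ⊎-map there there (partners⁻ cs m')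
... | no _     | yes refl | here refl = inj₂ (here refl)
... | no _     | yes _    | there m'  = ⊎-map there there (partners⁻ cs m')
... | no _     | no _     | m'        = ⊎-map there there (partners⁻ cs m')

nbrs : ℕ → BTree → List ℕ
nbrs a t = partners a (cherries t)

nbrs-absent : ∀ a t → a ∉ leaves t → nbrs a t ≡ []
nbrs-absent a t a∉t with nbrs a t in eq
... | [] = refl
... | b ∷ _ = ⊥-elim (a∉t (cherryOf-leaf t (partners⁻ (cherries t) (subst (b ∈_) (sym eq) (here refl)))))

-- A subtree in which a has a partner is not a leaf, so the cherries of the
-- parent split; if a does not occur on the other side, the partners of a
-- at the parent are those in this subtree.
nbrs-left : ∀ {a b} l r → b ∈ nbrs a l → a ∉ leaves r → nbrs a (node l r) ≡ nbrs a l
nbrs-left {a} l r b∈ a∉r with nodeShape l r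
... | inner eq = begin
  partners a (cherries (node l r))            ≡⟨ cong (partners a) eq ⟩
  partners a (cherries l ++ cherries r)       ≡⟨ partners-++ a (cherries l) (cherries r) ⟩
  nbrs a l ++ nbrs a r                        ≡⟨ cong (nbrs a l ++_) (nbrs-absent a r a∉r) ⟩
  nbrs a l ++ []                              ≡⟨ ++-identityʳ (nbrs a l) ⟩
  nbrs a l                                    ∎
  where open ≡-Reasoning

nbrs-right : ∀ {a b} l r → b ∈ nbrs a r → a ∉ leaves l → nbrs a (node l r) ≡ nbrs a r
nbrs-right {a} l r b∈ a∉l with nodeShape l r
... | inner eq = begin
  partners a (cherries (node l r))            ≡⟨ cong (partners a) eq ⟩
  partners a (cherries l ++ cherries r)       ≡⟨ partners-++ a (cherries l) (cherries r) ⟩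
  nbrs a l ++ nbrs a r                        ≡⟨ cong (_++ nbrs a r) (nbrs-absent a l a∉l) ⟩
  nbrs a r                                    ∎
  where open ≡-Reasoning

KeepsNbrs : List ℕ → ℕ → BTree → Set
KeepsNbrs B a t = ∃[ u ] (del B t ≡ just u × nbrs a u ≡ nbrs a t)

-- If the partners of a are kept in the subtree containing a, they are kept
-- at the parent: the other subtree contributes no partner of a, before or
-- after deletion.
keeps-left : ∀ {B a b} l r → KeepsNbrs B a l → b ∈ nbrs a l → a ∉ leaves r → KeepsNbrs B a (node l r)
keeps-left {B} {a} {b} l r (u , del-l , same) b∈l a∉r
  rewrite del-node B l r | del-l with del B r in del-r
... | nothing = u , refl , trans same (sym (nbrs-left l r b∈l a∉r))
... | just v  = node u v , refl , (begin
  nbrs a (node u v)     ≡⟨ nbrs-left u v (subst (b ∈_) (sym same) b∈l) (a∉r ∘ del-⊆ B {r} del-r) ⟩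
  nbrs a u              ≡⟨ same ⟩
  nbrs a l              ≡⟨ sym (nbrs-left l r b∈l a∉r) ⟩
  nbrs a (node l r)     ∎)
  where open ≡-Reasoning

keeps-right : ∀ {B a b} l r → KeepsNbrs B a r → b ∈ nbrs a r → a ∉ leaves l → KeepsNbrs B a (node l r)
keeps-right {B} {a} {b} l r (u , del-r , same) b∈r a∉l
  rewrite del-node B l r | del-r with del B l in del-l
... | nothing = u , refl , trans same (sym (nbrs-right l r b∈r a∉l))
... | just v  = node v u , refl , (begin
  nbrs a (node v u)     ≡⟨ nbrs-right v u (subst (b ∈_) (sym same) b∈r) (a∉l ∘ del-⊆ B {l} del-l) ⟩
  nbrs a u              ≡⟨ same ⟩
  nbrs a r              ≡⟨ sym (nbrs-right l r b∈r a∉l) ⟩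
  nbrs a (node l r)     ∎)
  where open ≡-Reasoning

keeps-pair : ∀ {B a p q} → p ∉ B → q ∉ B → KeepsNbrs B a (node (leaf p) (leaf q))
keeps-pair {B} {p = p} {q} p∉B q∉B
  rewrite del-node B (leaf p) (leaf q) | del-leaf {B} p∉B | del-leaf {B} q∉B = _ , refl , refl

del-keeps-nbrs : ∀ B {a z} t → Unique (leaves t) → CherryOf a z t → a ∉ B → z ∉ B → KeepsNbrs B a t
del-keeps-nbrs B (leaf _) _ (inj₁ ())
del-keeps-nbrs B (leaf _) _ (inj₂ ())
del-keeps-nbrs B {a} (node l r) U c a∉B z∉B with nodeShape l r
... | leafPair p q with c
...   | inj₁ (here refl) = keeps-pair {B} {a} a∉B z∉B
...   | inj₂ (here refl) = keeps-pair {B} {a} z∉B a∉B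
del-keeps-nbrs B (node l r) U c a∉B z∉B | inner eq with cherryOf-inner l r eq c
... | inj₁ cl = keeps-left l r (del-keeps-nbrs B l (unique-++ˡ {leaves l} U) cl a∉B z∉B)
                           (partners⁺ (cherries l) cl) (unique-disjoint {leaves l} U (cherryOf-leaf l cl))
... | inj₂ cr = keeps-right l r (del-keeps-nbrs B r (unique-++ʳ {leaves l} U) cr a∉B z∉B)
                            (partners⁺ (cherries r) cr) (λ a∈l → unique-disjoint {leaves l} U a∈l (cherryOf-leaf r cr))

nbrsᶠ : ℕ → List BTree → List ℕ
nbrsᶠ a T = concatMap (nbrs a) T

cherryIn⇒nbrsᶠ : ∀ {a b} T → CherryIn a b T → b ∈ nbrsᶠ a T
cherryIn⇒nbrsᶠ {a} T (t , t∈T , c) = ∈-concatMap⁺ (nbrs a) (lose t∈T (partners⁺ (cherries t) c))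

nbrsᶠ⇒cherryIn : ∀ {a b} T → b ∈ nbrsᶠ a T → CherryIn a b T
nbrsᶠ⇒cherryIn {a} T b∈ = let t , t∈T , b∈t = find (∈-concatMap⁻ (nbrs a) {xs = T} b∈) in t , t∈T , partners⁻ (cherries t) b∈t

w-resp : ∀ {a} T₁ T₂ → nbrsᶠ a T₁ ≡ nbrsᶠ a T₂ → w T₁ a ≡ w T₂ a
w-resp T₁ T₂ e = cong (λ L → length (deduplicate _≟_ L) ∸ 1) e

view-transfer : ∀ {a b} T₁ T₂ → nbrsᶠ a T₁ ≡ nbrsᶠ a T₂ →
  CherryIn a b T₁ × 0 < w T₁ a → CherryIn a b T₂ × 0 < w T₂ a
view-transfer {b = b} T₁ T₂ e (cin , w>0) =
  nbrsᶠ⇒cherryIn T₂ (subst (b ∈_) e (cherryIn⇒nbrsᶠ T₁ cin)) , subst (0 <_) (w-resp T₁ T₂ e) w>0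

∈-mapMaybe⁺ : ∀ {f : BTree → Maybe BTree} {t u} T → t ∈ T → f t ≡ just u → u ∈ mapMaybe f T
∈-mapMaybe⁺ {f} (t ∷ T) (here refl) e rewrite e = here refl
∈-mapMaybe⁺ {f} (t′ ∷ T) (there t∈T) e with f t′
... | just _  = there (∈-mapMaybe⁺ T t∈T e)
... | nothing = ∈-mapMaybe⁺ T t∈T e

∈-mapMaybe⁻ : ∀ {f : BTree → Maybe BTree} {u} T → u ∈ mapMaybe f T → ∃[ t ] (t ∈ T × f t ≡ just u)
∈-mapMaybe⁻ {f} (t ∷ T) u∈ with f t in e | u∈
... | just _  | here refl = t , here refl , e
... | just _  | there u∈′ = let t′ , t′∈T , e′ = ∈-mapMaybe⁻ T u∈′ in t′ , there t′∈T , e′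
... | nothing | u∈′       = let t′ , t′∈T , e′ = ∈-mapMaybe⁻ T u∈′ in t′ , there t′∈T , e′

∖-resp-≐ : ∀ {A B} T → A ≐ B → T ∖ A ≡ T ∖ B
∖-resp-≐ T A≐B = mapMaybe-cong (del-resp-≐ A≐B) T

∖-[] : ∀ T → T ∖ [] ≡ T
∖-[] []      = refl
∖-[] (t ∷ T) rewrite del-[] t = cong (t ∷_) (∖-[] T)

nbrsᵐ : ℕ → Maybe BTree → List ℕ
nbrsᵐ a nothing  = []
nbrsᵐ a (just u) = nbrs a u

nbrsᶠ-∖ : ∀ a A T → nbrsᶠ a (T ∖ A) ≡ concatMap (nbrsᵐ a ∘ del A) T
nbrsᶠ-∖ a A [] = refl
nbrsᶠ-∖ a A (t ∷ T) with del A t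
... | just u  = cong (nbrs a u ++_) (nbrsᶠ-∖ a A T)
... | nothing = nbrsᶠ-∖ a A T

concatMap-cong-∈ : ∀ {f g : BTree → List ℕ} T → (∀ {t} → t ∈ T → f t ≡ g t) → concatMap f T ≡ concatMap g T
concatMap-cong-∈ T f≗g = cong concat (map-cong-local (All.tabulate f≗g))

-- pickCost T q l: the weight spent picking all leaves of l, in order, after q.
-- The weight of a sequence omits its last leaf, hence the side condition in
-- the splitting lemmas below.
pickCost : List BTree → List ℕ → List ℕ → ℕ
pickCost T q []      = 0
pickCost T q (a ∷ l) = w (T ∖ q) a + pickCost T (q ++ [ a ]) l

++-≢[] : ∀ {A : Set} (p r : List A) → r ≢ [] → p ++ r ≢ []
++-≢[] []      r r≢[] = r≢[]
++-≢[] (_ ∷ _) r _    ()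

weightAux-∷ : ∀ T q a l → l ≢ [] → weightAux T q (a ∷ l) ≡ w (T ∖ q) a + weightAux T (q ++ [ a ]) l
weightAux-∷ T q a []      l≢[] = ⊥-elim (l≢[] refl)
weightAux-∷ T q a (_ ∷ _) _    = refl

weightAux-++ : ∀ T q p r → r ≢ [] → weightAux T q (p ++ r) ≡ pickCost T q p + weightAux T (q ++ p) r
weightAux-++ T q [] r _ rewrite ++-identityʳ q = refl
weightAux-++ T q (a ∷ p) r r≢[] = begin
  weightAux T q (a ∷ p ++ r)                                     ≡⟨ weightAux-∷ T q a (p ++ r) (++-≢[] p r r≢[]) ⟩
  w (T ∖ q) a + weightAux T (q ++ [ a ]) (p ++ r)                ≡⟨ cong (w (T ∖ q) a +_) (weightAux-++ T (q ++ [ a ]) p r r≢[]) ⟩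
  w (T ∖ q) a + (pickCost T (q ++ [ a ]) p + weightAux T ((q ++ [ a ]) ++ p) r)
                                                                 ≡⟨ sym (+-assoc (w (T ∖ q) a) _ _) ⟩
  pickCost T q (a ∷ p) + weightAux T ((q ++ [ a ]) ++ p) r       ≡⟨ cong (λ q′ → pickCost T q (a ∷ p) + weightAux T q′ r) (++-assoc q [ a ] p) ⟩
  pickCost T q (a ∷ p) + weightAux T (q ++ a ∷ p) r              ∎
  where open ≡-Reasoning

weightAux-resp-≐ : ∀ T {q q′} l → q ≐ q′ → weightAux T q l ≡ weightAux T q′ l
weightAux-resp-≐ T []          _    = refl
weightAux-resp-≐ T (a ∷ [])    _    = refl
weightAux-resp-≐ T (a ∷ b ∷ l) q≐q′ =
  cong₂ _+_ (cong (λ U → w U a) (∖-resp-≐ T q≐q′)) (weightAux-resp-≐ T (b ∷ l) (≐-∷ʳ a q≐q′))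

weightAux-empty : ∀ T → T ≡ [] → ∀ q l → weightAux T q l ≡ 0
weightAux-empty _ refl q []          = refl
weightAux-empty _ refl q (a ∷ [])    = refl
weightAux-empty _ refl q (a ∷ b ∷ l) = weightAux-empty [] refl (q ++ [ a ]) (b ∷ l)

++-∷-split : ∀ {A : Set} (p rest q : List A) z r → p ++ rest ≡ q ++ z ∷ r →
  (∃[ p₂ ] (p ≡ q ++ z ∷ p₂ × r ≡ p₂ ++ rest)) ⊎ (∃[ r₁ ] (q ≡ p ++ r₁ × rest ≡ r₁ ++ z ∷ r))
++-∷-split []      rest q       z r e = inj₂ (q , refl , e)
++-∷-split (a ∷ p) rest []      z r refl = inj₁ (p , refl , refl)
++-∷-split (a ∷ p) rest (b ∷ q) z r e with ∷-injective e
... | refl , e′ with ++-∷-split p rest q z r e′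
...   | inj₁ (p₂ , refl , r≡) = inj₁ (p₂ , refl , r≡)
...   | inj₂ (r₁ , refl , rest≡) = inj₂ (r₁ , refl , rest≡)

first-occurrence : ∀ {x : ℕ} {s} → x ∈ s → ∃[ p ] ∃[ rest ] (s ≡ p ++ x ∷ rest × x ∉ p)
first-occurrence {x} {a ∷ s} x∈ with x ≟ a | x∈
... | yes refl | _          = [] , s , refl , λ ()
... | no x≢a   | here x≡a   = ⊥-elim (x≢a x≡a)
... | no x≢a   | there x∈s  =
  let p , rest , s≡ , x∉p = first-occurrence x∈s
  in a ∷ p , rest , cong (a ∷_) s≡ , λ { (here x≡a) → x≢a x≡a ; (there x∈p) → x∉p x∈p }

first-occurrence-prefix : ∀ {x : ℕ} p p′ {r r′} → p ++ x ∷ r ≡ p′ ++ x ∷ r′ → x ∉ p → p ⊆ p′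
first-occurrence-prefix (a ∷ p) []       e x∉p _ with ∷-injective e
... | refl , _ = ⊥-elim (x∉p (here refl))
first-occurrence-prefix (a ∷ p) (b ∷ p′) e x∉p y∈ with ∷-injective e | y∈
... | refl , _  | here refl = here refl
... | refl , e′ | there y∈p = there (first-occurrence-prefix p p′ e′ (x∉p ∘ there) y∈p)

empty-or-inhabited : ∀ {A : Set} (xs : List A) → xs ≡ [] ⊎ ∃[ a ] (a ∈ xs)
empty-or-inhabited []      = inj₁ refl
empty-or-inhabited (a ∷ _) = inj₂ (a , here refl)

module PrefixAvoiding (T : List BTree) (uniq : ∀ {t} → t ∈ T → Unique (leaves t))
  {x : ℕ} (xH : InH x T) {p : List ℕ} (x∉p : x ∉ p) (p∉N : ∀ {y} → y ∈ p → y ∉ N T x) where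

  partner⇒N : ∀ {t y} → t ∈ T → CherryOf x y t → y ∈ N T x
  partner⇒N t∈T c = ∈-deduplicate⁺ _≟_ (cherryIn⇒nbrsᶠ T (_ , t∈T , c))

  x-kept : ∀ {A t} → A ⊆ p → t ∈ T → KeepsNbrs A x t
  x-kept {A} {t} A⊆p t∈T with xH t t∈T
  ... | y , c = del-keeps-nbrs A t (uniq t∈T) c (x∉p ∘ A⊆p) (λ y∈A → p∉N (A⊆p y∈A) (partner⇒N t∈T c))

  x-view-stable : ∀ {A} → A ⊆ p → nbrsᶠ x (T ∖ A) ≡ nbrsᶠ x T
  x-view-stable {A} A⊆p = trans (nbrsᶠ-∖ x A T) (concatMap-cong-∈ T kept)
    where
    kept : ∀ {t} → t ∈ T → nbrsᵐ x (del A t) ≡ nbrs x t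
    kept t∈T with x-kept A⊆p t∈T
    ... | _ , del≡ , same rewrite del≡ = same

  ∉[x] : ∀ {a} → a ∈ p → a ∉ [ x ]
  ∉[x] a∈p (here refl) = x∉p a∈p

  partner-∉[x] : ∀ {a z t u} → a ∈ p → t ∈ T → nbrs x u ≡ nbrs x t → CherryOf a z u → z ∉ [ x ]
  partner-∉[x] {a} {t = t} {u} a∈p t∈T same c (here refl) =
    p∉N a∈p (partner⇒N t∈T (partners⁻ (cherries t) (subst (a ∈_) same (partners⁺ (cherries u) (⊎-swap c)))))

  a-kept : ∀ {a A t} → a ∈ p → A ⊆ p → InH a (T ∖ A) → t ∈ T →
    ∃[ u ] ∃[ u′ ] (del A t ≡ just u × del (x ∷ A) t ≡ just u′ × nbrs a u′ ≡ nbrs a u)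
  a-kept {a} {A} {t} a∈p A⊆p aH t∈T with x-kept A⊆p t∈T
  ... | u , del-u , x-same with aH u (∈-mapMaybe⁺ T t∈T del-u)
  ...   | z , c with del-keeps-nbrs [ x ] u (del-unique A {t} del-u (uniq t∈T)) c (∉[x] a∈p) (partner-∉[x] {u = u} a∈p t∈T x-same c)
  ...     | u′ , del-u′ , a-same =
    u , u′ , del-u , trans (del-++ [ x ] A t) (trans (cong (_>>= del [ x ]) del-u) del-u′) , a-same

  x-invisible-to : ∀ {a A} → a ∈ p → A ⊆ p → InH a (T ∖ A) →
    nbrsᶠ a (T ∖ (x ∷ A)) ≡ nbrsᶠ a (T ∖ A) × InH a (T ∖ (x ∷ A))
  x-invisible-to {a} {A} a∈p A⊆p aH = view , inH
    where
    same : ∀ {t} → t ∈ T → nbrsᵐ a (del (x ∷ A) t) ≡ nbrsᵐ a (del A t)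
    same t∈T with a-kept a∈p A⊆p aH t∈T
    ... | _ , _ , del-u , del-u′ , a-same rewrite del-u | del-u′ = a-same

    view : nbrsᶠ a (T ∖ (x ∷ A)) ≡ nbrsᶠ a (T ∖ A)
    view = begin
      nbrsᶠ a (T ∖ (x ∷ A))                  ≡⟨ nbrsᶠ-∖ a (x ∷ A) T ⟩
      concatMap (nbrsᵐ a ∘ del (x ∷ A)) T    ≡⟨ concatMap-cong-∈ T same ⟩
      concatMap (nbrsᵐ a ∘ del A) T          ≡⟨ sym (nbrsᶠ-∖ a A T) ⟩
      nbrsᶠ a (T ∖ A)                        ∎
      where open ≡-Reasoning

    inH : InH a (T ∖ (x ∷ A))
    inH u″ u″∈ with ∈-mapMaybe⁻ T u″∈
    ... | t , t∈T , del-u″ with a-kept a∈p A⊆p aH t∈T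
    ...   | u , u′ , del-u , del-u′ , a-same with aH u (∈-mapMaybe⁺ T t∈T del-u)
    ...     | z , c = z , subst (CherryOf a z) (just-injective (trans (sym del-u′) del-u″))
                                (partners⁻ (cherries u′) (subst (z ∈_) (sym a-same) (partners⁺ (cherries u) c)))

module MoveToFront (X : List ℕ) (UX : Unique X) (T : List BTree) (TX : ∀ t → t ∈ T → IsXTree X t)
  {s : List ℕ} (cps : IsCPS T X s) {x : ℕ} (xH : InH x T) {p rest : List ℕ} (s≡ : s ≡ p ++ x ∷ rest)
  (x∉p : x ∉ p) (p∉N : ∀ {y} → y ∈ p → y ∉ N T x) where

  uniq : ∀ {t} → t ∈ T → Unique (leaves t)
  uniq {t} t∈T = Unique-resp-↭ (↭⇒↭ₛ (↭-sym (TX t t∈T))) UX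

  open PrefixAvoiding T uniq xH x∉p p∉N

  cps-H : ∀ q z r → s ≡ q ++ z ∷ r → r ≢ [] → InH z (T ∖ q)
  cps-H = proj₂ cps

  picked-before-x : ∀ {q a p₂} → p ≡ q ++ a ∷ p₂ →
    nbrsᶠ a (T ∖ (x ∷ q)) ≡ nbrsᶠ a (T ∖ q) × InH a (T ∖ (x ∷ q))
  picked-before-x {q} {a} {p₂} p≡ = x-invisible-to a∈p q⊆p (cps-H q a (p₂ ++ x ∷ rest) s≡′ (++-≢[] p₂ (x ∷ rest) λ ()))
    where
    a∈p : a ∈ p
    a∈p = subst (a ∈_) (sym p≡) (∈-++⁺ʳ q (here refl))
    q⊆p : q ⊆ p
    q⊆p = subst (q ⊆_) (sym p≡) (xs⊆xs++ys q (a ∷ p₂))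
    s≡′ : s ≡ q ++ a ∷ (p₂ ++ x ∷ rest)
    s≡′ = trans s≡ (trans (cong (_++ x ∷ rest) p≡) (++-assoc q (a ∷ p₂) (x ∷ rest)))

  -- For a leaf picked after x, the same leaves have been picked before it.
  picked-after-x : ∀ r₁ → T ∖ (x ∷ p ++ r₁) ≡ T ∖ (p ++ x ∷ r₁)
  picked-after-x r₁ = ∖-resp-≐ T (move-front-≐ x p r₁)

  s-after-x : ∀ {r₁ z r} → rest ≡ r₁ ++ z ∷ r → s ≡ (p ++ x ∷ r₁) ++ z ∷ r
  s-after-x {r₁} {z} {r} rest≡ = trans s≡ (trans (cong (λ L → p ++ x ∷ L) rest≡) (sym (++-assoc p (x ∷ r₁) (z ∷ r))))

  moved-CPS : IsCPS T X (x ∷ p ++ rest)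
  moved-CPS = ↭-trans (↭-sym (shift x p rest)) (subst (_↭ X) s≡ (proj₁ cps)) , moved-H
    where
    moved-H : ∀ q z r → x ∷ p ++ rest ≡ q ++ z ∷ r → r ≢ [] → InH z (T ∖ q)
    moved-H [] z r refl _ = subst (InH x) (sym (∖-[] T)) xH
    moved-H (_ ∷ q) z r e r≢[] with ∷-injective e
    ... | refl , e′ with ++-∷-split p rest q z r e′
    ...   | inj₁ (_ , p≡ , _)        = proj₂ (picked-before-x p≡)
    ...   | inj₂ (r₁ , refl , rest≡) =
      subst (InH z) (sym (picked-after-x r₁)) (cps-H (p ++ x ∷ r₁) z r (s-after-x rest≡) r≢[])

  moved-satisfies : ∀ {C} → Satisfies T C s → Satisfies T C (x ∷ p ++ rest)
  moved-satisfies sat a b ab with sat a b ab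
  ... | q , r , s≡q , picked with ++-∷-split p (x ∷ rest) q a r (trans (sym s≡) s≡q)
  ...   | inj₁ (p₂ , p≡ , _) =
    x ∷ q , p₂ ++ rest , cong (x ∷_) (trans (cong (_++ rest) p≡) (++-assoc q (a ∷ p₂) rest)) ,
    view-transfer (T ∖ q) (T ∖ (x ∷ q)) (sym (proj₁ (picked-before-x p≡))) picked
  ...   | inj₂ ([] , refl , x∷rest≡) with ∷-injective x∷rest≡
  ...     | refl , _ = [] , p ++ rest , refl ,
    view-transfer (T ∖ (p ++ [])) (T ∖ []) (trans (x-view-stable (⊆-reflexive (++-identityʳ p))) (sym (x-view-stable λ ()))) picked
  moved-satisfies sat a b ab | q , r , s≡q , picked | inj₂ (_ ∷ r₁ , refl , x∷rest≡) with ∷-injective x∷rest≡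
  ... | refl , rest≡ =
    x ∷ p ++ r₁ , r , cong (x ∷_) (trans (cong (p ++_) rest≡) (sym (++-assoc p r₁ (a ∷ r)))) ,
    subst (λ U → CherryIn a b U × 0 < w U a) (sym (picked-after-x r₁)) picked

  pickCost-x-first : ∀ p₁ l → p ≡ p₁ ++ l → pickCost T (x ∷ p₁) l ≡ pickCost T p₁ l
  pickCost-x-first p₁ []      _  = refl
  pickCost-x-first p₁ (a ∷ l) p≡ =
    cong₂ _+_ (w-resp (T ∖ (x ∷ p₁)) (T ∖ p₁) (proj₁ (picked-before-x p≡)))
              (pickCost-x-first (p₁ ++ [ a ]) l (trans p≡ (sym (++-assoc p₁ [ a ] l))))

  -- x has a partner in every tree, which comes after x in s: x is not last.
  rest-nonempty : ∀ {t} → t ∈ T → rest ≢ []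
  rest-nonempty {t} t∈T rest≡[] with xH t t∈T
  ... | y , c with ∈-++⁻ p (subst (y ∈_) s≡ (∈-resp-↭ (↭-sym (proj₁ cps)) (∈-resp-↭ (TX t t∈T) (cherryOf-leaf t (⊎-swap c)))))
  ...   | inj₁ y∈p            = p∉N y∈p (partner⇒N t∈T c)
  ...   | inj₂ (here refl)    = no-self-cherry t (uniq t∈T) c
  ...   | inj₂ (there y∈rest) with subst (y ∈_) rest≡[] y∈rest
  ...     | ()

  moved-weight-nonempty : rest ≢ [] → weight T (x ∷ p ++ rest) ≡ weight T s
  moved-weight-nonempty rest≢[] = begin
    weightAux T [] (x ∷ p ++ rest)                                   ≡⟨ weightAux-∷ T [] x (p ++ rest) (++-≢[] p rest rest≢[]) ⟩
    w (T ∖ []) x + weightAux T [ x ] (p ++ rest)                     ≡⟨ cong (w (T ∖ []) x +_) (weightAux-++ T [ x ] p rest rest≢[]) ⟩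
    w (T ∖ []) x + (pickCost T [ x ] p + weightAux T (x ∷ p) rest)   ≡⟨ x∙yz≈y∙xz (w (T ∖ []) x) (pickCost T [ x ] p) (weightAux T (x ∷ p) rest) ⟩
    pickCost T [ x ] p + (w (T ∖ []) x + weightAux T (x ∷ p) rest)   ≡⟨ cong₂ _+_ (pickCost-x-first [] p refl) (cong₂ _+_ x-weight later) ⟩
    pickCost T [] p + (w (T ∖ p) x + weightAux T (p ++ [ x ]) rest)  ≡⟨ cong (pickCost T [] p +_) (sym (weightAux-∷ T p x rest rest≢[])) ⟩
    pickCost T [] p + weightAux T p (x ∷ rest)                        ≡⟨ sym (weightAux-++ T [] p (x ∷ rest) λ ()) ⟩
    weightAux T [] (p ++ x ∷ rest)                                    ≡⟨ cong (weightAux T []) (sym s≡) ⟩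
    weightAux T [] s                                                  ∎
    where
    open ≡-Reasoning
    x-weight : w (T ∖ []) x ≡ w (T ∖ p) x
    x-weight = w-resp (T ∖ []) (T ∖ p) (trans (x-view-stable λ ()) (sym (x-view-stable λ y∈p → y∈p)))
    later : weightAux T (x ∷ p) rest ≡ weightAux T (p ++ [ x ]) rest
    later = weightAux-resp-≐ T rest (subst (λ L → x ∷ L ≐ p ++ [ x ]) (++-identityʳ p) (move-front-≐ x p []))

  moved-weight : weight T (x ∷ p ++ rest) ≡ weight T s
  moved-weight with empty-or-inhabited T
  ... | inj₁ T≡[]      = trans (weightAux-empty T T≡[] [] (x ∷ p ++ rest)) (sym (weightAux-empty T T≡[] [] s))
  ... | inj₂ (_ , t∈T) = moved-weight-nonempty (rest-nonempty t∈T)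

mainTheorem5 : (X : List ℕ) → Unique X → (T : List BTree) → (∀ t → t ∈ T → IsXTree X t) →
    (C : List (ℕ × ℕ)) → IsConstraintSet T C →
    (s : List ℕ) → IsCPS T X s → Satisfies T C s →
    (x : ℕ) → InH x T →
    (∃[ p ] ∃[ rest ] (s ≡ p ++ x ∷ rest × IsCPS T X (x ∷ p ++ rest) × Satisfies T C (x ∷ p ++ rest) × weight T (x ∷ p ++ rest) ≡ weight T s))
    ⊎ (∀ p rest → s ≡ p ++ x ∷ rest → ∃[ y ] (y ∈ p × y ∈ N T x))
mainTheorem5 X UX T TX C _ s cps sat x xH with x ∈? s
... | no x∉s = inj₂ λ p _ s≡ → ⊥-elim (x∉s (subst (x ∈_) (sym s≡) (∈-++⁺ʳ p (here refl))))
... | yes x∈s with first-occurrence x∈s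
...   | p , rest , s≡ , x∉p with any? (_∈? N T x) p
...     | yes partner-in-p = inj₂ λ p′ _ s≡′ →
  let y , y∈p , y∈N = find partner-in-p in y , first-occurrence-prefix p p′ (trans (sym s≡) s≡′) x∉p y∈p , y∈N
...     | no no-partner-in-p = inj₁ (p , rest , s≡ , moved-CPS , moved-satisfies sat , moved-weight)
  where open MoveToFront X UX T TX cps xH s≡ x∉p (λ y∈p y∈N → no-partner-in-p (lose y∈p y∈N))
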